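{- Let $G$ be a connected graph with a standard ordering $e_1<\dots<e_q$, let $k=q-|V(G)|+1$ with $k\ge 2$, and suppose $e_k$ and $e_{k-1}$ have the same endpoints. Give $G\setminus e_k$ the induced ordering $e_1<\dots<e_{k-1}<e_{k+1}<\dots<e_q$ (which is standard). Then $R(G)\cong R(G\setminus e_k)$.
   Context: Graphs are finite and may have loops and multiple edges. For a graph $G$ with $p$ vertices and $q$ edges put $k=q-p+1$. A total ordering of $E(G)$ with edges listed in increasing order is standard if $G$ is connected and the last $p-1$ edges in the order form a spanning tree $T$ of $G$ (the first $k$ edges are the non-tree edges). Work over $\mathbb{Z}_2$ with one variable $x_e$ for each edge $e$; for $S\subseteq E(G)$, $\mathbf{x}^S=\prod_{e\in S}x_e$. A circuit is the edge set of a cycle of $G$; its broken circuit is $\bar C=C\setminus\{\min C\}$ (minimum in the ordering). For each tree edge $f$, $D_f$ is the set of edges with one endpoint in each component of $T-f$, and $\theta_f=\sum_{e\in D_f}x_e$. Let $I(G)$ be the ideal generated by all $\mathbf{x}^{\bar C}$ and $R(G)=\mathbb{Z}_2[x_e:e\in E(G)]/(I(G)+\langle\theta_f: f\in T\rangle)$. -}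

module Defs where

open import Level using (0ℓ)
open import Data.Unit using (⊤)
open import Data.Nat as ℕ using (ℕ; zero; suc; _∸_; _≤_; _≤ᵇ_)
open import Data.Nat.Properties using () renaming (_≟_ to _≟ℕ_)
open import Data.Bool using (Bool; true; false; if_then_else_; _∧_; not)
open import Data.Fin using (Fin; toℕ; inject₁; fromℕ; punchIn; _<_) renaming (zero to fz; suc to fs)
open import Data.Fin.Properties using (any?) renaming (_≟_ to _≟F_)
open import Data.Fin.Subset using (Subset; _∈_)
open import Data.Vec using (Vec; tabulate; lookup)
import Data.Vec.Properties as VecP
open import Data.List using (List; []; _∷_; _++_; map; filter; length; cartesianProductWith; concat)
open import Data.Product using (Σ; ∃; _×_; _,_; proj₁; proj₂)
open import Data.Sum using (_⊎_)
open import Relation.Nullary using (¬_; does)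
open import Relation.Binary.PropositionalEquality using (_≡_; _≢_)
open import Function.Bundles using (_⇔_)
open import Algebra.Bundles.Raw using (RawRing)
open import Algebra.Morphism.Structures using (module RingMorphisms)

-- Edges are Fin q, and the edge ordering e₁ < … < e_q is the
-- natural order of Fin q (edge e_i is the index i-1).

Graph : ℕ → ℕ → Set
Graph p q = Fin q → Fin p × Fin p

module _ {p q : ℕ} (G : Graph p q) where

  Joins : Fin q → Fin p → Fin p → Set
  Joins e u v = (proj₁ (G e) ≡ u × proj₂ (G e) ≡ v) ⊎ (proj₁ (G e) ≡ v × proj₂ (G e) ≡ u)

  data Conn (S : Fin q → Set) : Fin p → Fin p → Set where
    here : ∀ {u} → Conn S u u
    step : ∀ {u v w} (e : Fin q) → S e → Joins e u v → Conn S v w → Conn S u w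

  Connected : Set
  Connected = ∀ u v → Conn (λ _ → ⊤) u v

  record Cycle : Set where
    field
      m       : ℕ
      es      : Fin (suc m) → Fin q
      vs      : Fin (suc (suc m)) → Fin p
      closed  : vs (fromℕ (suc m)) ≡ vs fz
      es-inj  : ∀ i j → es i ≡ es j → i ≡ j
      vs-inj  : ∀ i j → vs (inject₁ i) ≡ vs (inject₁ j) → i ≡ j
      incid   : ∀ i → Joins (es i) (vs (inject₁ i)) (vs (fs i))

  kOf : ℕ
  kOf = suc q ∸ p

  -- tree edges: the last p - 1 edges (indices k, …, q-1)
  InTree : Fin q → Set
  InTree e = kOf ≤ toℕ e

  CycleIn : (Fin q → Set) → Set
  CycleIn S = Σ Cycle λ C → ∀ i → S (Cycle.es C i)

  IsSpanningTree : (Fin q → Set) → Set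
  IsSpanningTree S = (∀ u v → Conn S u v) × ¬ CycleIn S

  Standard : Set
  Standard = Connected × (p ≤ suc q) × IsSpanningTree InTree

  circuit : Cycle → Subset q
  circuit C = tabulate λ e → does (any? λ i → Cycle.es C i ≟F e)

  minF : ∀ {n} → Fin n → Fin n → Fin n
  minF a b = if toℕ a ≤ᵇ toℕ b then a else b

  minEdge : ∀ {m} → (Fin (suc m) → Fin q) → Fin q
  minEdge {zero}  es = es fz
  minEdge {suc m} es = minF (es fz) (minEdge (λ i → es (fs i)))

  brokenCircuit : Cycle → Subset q
  brokenCircuit C = tabulate λ e →
    lookup (circuit C) e ∧ not (does (e ≟F minEdge (Cycle.es C)))

  -- D_f: edges with one endpoint in each component of T - f
  TminusF : Fin q → Fin q → Set
  TminusF f e = InTree e × e ≢ f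

  InCut : Fin q → Fin q → Set
  InCut f e =
      (Conn (TminusF f) (proj₁ (G e)) (proj₁ (G f)) × Conn (TminusF f) (proj₂ (G e)) (proj₂ (G f)))
    ⊎ (Conn (TminusF f) (proj₁ (G e)) (proj₂ (G f)) × Conn (TminusF f) (proj₂ (G e)) (proj₁ (G f)))

-- A monomial is an exponent vector; a polynomial is a formal sum of
-- monomials (a list), the coefficient of a monomial being the parity of
-- its number of occurrences.

Monomial : ℕ → Set
Monomial n = Vec ℕ n

Poly : ℕ → Set
Poly n = List (Monomial n)

module _ {n : ℕ} where

  count : Monomial n → Poly n → ℕ
  count μ f = length (filter (VecP.≡-dec _≟ℕ_ μ) f)

  parity : ℕ → Bool
  parity zero = false
  parity (suc k) = not (parity k)

  coeff : Monomial n → Poly n → Bool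
  coeff μ f = parity (count μ f)

  _≈P_ : Poly n → Poly n → Set
  f ≈P g = ∀ μ → coeff μ f ≡ coeff μ g

  0P : Poly n
  0P = []

  1P : Poly n
  1P = tabulate (λ _ → 0) ∷ []

  _+P_ : Poly n → Poly n → Poly n
  f +P g = f ++ g

  _*P_ : Poly n → Poly n → Poly n
  f *P g = cartesianProductWith (λ a b → tabulate λ i → lookup a i ℕ.+ lookup b i) f g

  -- negation in characteristic 2
  -P_ : Poly n → Poly n
  -P f = f

  var : Fin n → Poly n
  var e = tabulate (λ i → if does (i ≟F e) then 1 else 0) ∷ []

  monomialOf : Subset n → Poly n
  monomialOf S = tabulate (λ i → if lookup S i then 1 else 0) ∷ []

  linearOf : Subset n → Poly n
  linearOf S = concat (Data.List.map (λ i → if lookup S i then var i else 0P) (Data.List.allFin n))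

  data Ideal (Gen : Poly n → Set) : Poly n → Set where
    ideal-0   : Ideal Gen 0P
    ideal-gen : ∀ a g → Gen g → Ideal Gen (a *P g)
    ideal-+   : ∀ {f g} → Ideal Gen f → Ideal Gen g → Ideal Gen (f +P g)
    ideal-≈   : ∀ {f g} → f ≈P g → Ideal Gen f → Ideal Gen g

  -- the quotient ring ℤ₂[x]/⟨Gen⟩ as a (raw) ring on Poly n with
  -- equality modulo the ideal (f - g = f + g in characteristic 2)
  QuotientRing : (Poly n → Set) → RawRing 0ℓ 0ℓ
  QuotientRing Gen = record
    { Carrier = Poly n
    ; _≈_ = λ f g → Ideal Gen (f +P g)
    ; _+_ = _+P_
    ; _*_ = _*P_
    ; -_ = -P_
    ; 0# = 0P
    ; 1# = 1P
    }

module _ {p q : ℕ} (G : Graph p q) where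

  Generators : Poly q → Set
  Generators g =
      (Σ (Cycle G) λ C → g ≡ monomialOf (brokenCircuit G C))
    ⊎ (Σ (Fin q) λ f → InTree G f × Σ (Subset q) λ D →
         ((∀ e → (e ∈ D) ⇔ InCut G f e) × g ≡ linearOf D))

  R : RawRing 0ℓ 0ℓ
  R = QuotientRing Generators

_≅R_ : RawRing 0ℓ 0ℓ → RawRing 0ℓ 0ℓ → Set
R₁ ≅R R₂ = Σ (RawRing.Carrier R₁ → RawRing.Carrier R₂) (RingMorphisms.IsRingIsomorphism R₁ R₂)

delete : ∀ {p q} → Graph p (suc q) → Fin (suc q) → Graph p q
delete G i e = G (punchIn i e)

SameEnds : ∀ {p q} → Graph p q → Fin q → Fin q → Set
SameEnds G a b = Joins G b (proj₁ (G a)) (proj₂ (G a))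

{-# OPTIONS --safe #-}
-- Setting x_{e_k} = 0 is a ring map ℤ₂[x_e : e ∈ E(G)] → ℤ₂[x_e : e ≠ e_k] with the inclusion as a
-- section. Since e_{k-1} < e_k are parallel, the digon {e_{k-1}, e_k} has broken circuit {e_k}, so
-- x_{e_k} ∈ I(G) and every f is congruent to f|_{x_{e_k} = 0} modulo I(G). The substitution sends
-- the generators of G to generators of G ∖ e_k or to 0: a broken circuit containing e_k dies, and
-- any other cycle either avoids e_k or has e_k as its minimum; then e_{k-1}, being smaller, is not
-- on it, and rerouting the cycle through e_{k-1} gives a cycle of G ∖ e_k with the same broken
-- circuit. As e_k is not a tree edge, G and G ∖ e_k have the same spanning tree and the same cuts
-- D_f, except that e_k ∈ D_f iff e_{k-1} ∈ D_f, so the θ_f agree up to a multiple of x_{e_k}.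

module Submission where

open import Defs
open import Data.Nat as ℕ using (ℕ; zero; suc; _+_; pred; _≤ᵇ_; s≤s)
import Data.Nat.Properties as ℕₚ
open import Data.Nat.Properties
  using (+-identityʳ; +-comm; 0≢1+n; ≤ᵇ⇒≤; ≤⇒≤ᵇ; ≰⇒≥; <⇒≱; <-≤-connex; +-∸-assoc; m∸n≢0⇒n<m)
  renaming (_≟_ to _≟ℕ_)
open import Data.Bool using (Bool; true; false; _xor_; _∧_; not; if_then_else_; T)
open import Data.Bool.Properties using (xor-assoc; xor-same)
open import Data.Fin using (Fin; toℕ; _≤_; _<_; inject₁; punchIn; punchOut; pinch) renaming (zero to fz; suc to fs)
open import Data.Fin.Properties
  using (punchIn-punchOut; punchInᵢ≢i; punchIn-injective; punchIn-mono-≤; pinch-mono-≤; toℕ-inject₁;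
         ≤-refl; ≤-trans; ≤-antisym; <-irrefl; any?)
  renaming (_≟_ to _≟F_)
open import Data.Fin.Subset using (Subset; _∈_)
open import Data.Vec using (Vec; tabulate; lookup; insertAt; removeAt; updateAt)
import Data.Vec.Properties as VecP
open import Data.Vec.Relation.Binary.Pointwise.Extensional using (ext; Pointwise-≡⇒≡)
open import Data.List using (List; []; _∷_; _++_; map; concat)
import Data.List as L
import Data.List.Properties as LP
import Data.List.Relation.Binary.Permutation.Propositional as ↭
open import Data.List.Relation.Binary.Permutation.Propositional
  using (_↭_; ↭-refl; ↭-trans; module PermutationReasoning)
open import Data.List.Relation.Binary.Permutation.Propositional.Properties
  using (↭-length; filter-↭; ++⁺; ++⁺ˡ; map⁺; shifts; shift; ++-comm; ++⁺ʳ)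
open import Data.Product as Prod using (∃; _×_; _,_; proj₁; proj₂)
open import Data.Sum as Sum using (_⊎_; inj₁; inj₂)
open import Data.Unit using (tt)
open import Data.Empty using (⊥-elim)
open import Relation.Nullary using (¬_; Dec; does; yes; no; ¬?; _×-dec_)
open import Relation.Nullary.Decidable using (dec-true; dec-false; does-⇔)
open import Relation.Binary using (Setoid; DecidableEquality)
open import Relation.Binary.PropositionalEquality
open import Function using (_∘_)
import Relation.Binary.Reasoning.Setoid as SetoidReasoning
open import Function.Bundles using (_⇔_; mk⇔; Equivalence)
open import Function.Properties.Equivalence using (⇔-setoid)
open import Level using (0ℓ)

lookup-ext : ∀ {a} {A : Set a} {n} {xs ys : Vec A n} → (∀ i → lookup xs i ≡ lookup ys i) → xs ≡ ys
lookup-ext eq = Pointwise-≡⇒≡ (ext eq)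

data PunchInView {n} (k : Fin (suc n)) : Fin (suc n) → Set where
  hole    : PunchInView k k
  punched : ∀ e → PunchInView k (punchIn k e)

punchInView : ∀ {n} (k i : Fin (suc n)) → PunchInView k i
punchInView k i with k ≟F i
... | yes refl = hole
... | no k≢i   = subst (PunchInView k) (punchIn-punchOut k≢i) (punched (punchOut k≢i))

module _ {a} {A : Set a} {n : ℕ} where

  lookup-removeAt : ∀ (xs : Vec A (suc n)) k e → lookup (removeAt xs k) e ≡ lookup xs (punchIn k e)
  lookup-removeAt xs k e = begin
    lookup (removeAt xs k) e                                        ≡⟨ VecP.insertAt-punchIn _ k (lookup xs k) e ⟨
    lookup (insertAt (removeAt xs k) k (lookup xs k)) (punchIn k e) ≡⟨ cong (λ ys → lookup ys (punchIn k e))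
                                                                            (VecP.insertAt-removeAt xs k) ⟩
    lookup xs (punchIn k e)                                         ∎
    where open ≡-Reasoning

  ≡-insertAt : ∀ {xs : Vec A (suc n)} {ys k v} →
               lookup xs k ≡ v → (∀ e → lookup xs (punchIn k e) ≡ lookup ys e) → xs ≡ insertAt ys k v
  ≡-insertAt {xs} {ys} {k} xs[k]≡v xs∘punchIn≡ys = lookup-ext pointwise
    where
    pointwise : ∀ i → lookup xs i ≡ lookup (insertAt ys k _) i
    pointwise i with punchInView k i
    ... | hole      = trans xs[k]≡v (sym (VecP.insertAt-lookup ys k _))
    ... | punched e = trans (xs∘punchIn≡ys e) (sym (VecP.insertAt-punchIn ys k _ e))

concat-tabulate-↭ : ∀ {a} {A : Set a} {n} (g : Fin (suc n) → List A) k →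
                    concat (L.tabulate g) ↭ g k ++ concat (L.tabulate (g ∘ punchIn k))
concat-tabulate-↭ g fz = ↭-refl
concat-tabulate-↭ {n = suc n} g (fs k) = begin
  g fz ++ concat (L.tabulate (g ∘ fs))                          ↭⟨ ++⁺ˡ (g fz) (concat-tabulate-↭ (g ∘ fs) k) ⟩
  g fz ++ g (fs k) ++ concat (L.tabulate (g ∘ fs ∘ punchIn k))  ↭⟨ shifts (g fz) (g (fs k)) ⟩
  g (fs k) ++ g fz ++ concat (L.tabulate (g ∘ fs ∘ punchIn k))  ∎
  where open PermutationReasoning

toℕ-punchIn-≥ : ∀ {n} (k : Fin (suc n)) e → toℕ k ℕ.≤ toℕ e → toℕ (punchIn k e) ≡ suc (toℕ e)
toℕ-punchIn-≥ fz     e      _           = refl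
toℕ-punchIn-≥ (fs k) (fs e) (s≤s k≤e)   = cong suc (toℕ-punchIn-≥ k e k≤e)

toℕ-punchIn-< : ∀ {n} (k : Fin (suc n)) e → toℕ e ℕ.< toℕ k → toℕ (punchIn k e) ≡ toℕ e
toℕ-punchIn-< (fs k) fz     _           = refl
toℕ-punchIn-< (fs k) (fs e) (s≤s e<k)   = cong suc (toℕ-punchIn-< k e e<k)

punchIn-pinch : ∀ {n} (j : Fin n) x → x ≢ fs j → punchIn (fs j) (pinch j x) ≡ x
punchIn-pinch {suc n} j      fz          _    = refl
punchIn-pinch {suc n} fz     (fs fz)     x≢1  = ⊥-elim (x≢1 refl)
punchIn-pinch {suc n} fz     (fs (fs x)) _    = refl
punchIn-pinch {suc n} (fs j) (fs x)      x≢j′ = cong fs (punchIn-pinch j x (x≢j′ ∘ cong fs))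

pinch-punchIn : ∀ {n} (j : Fin n) e → pinch j (punchIn (fs j) e) ≡ e
pinch-punchIn {suc n} fz     fz     = refl
pinch-punchIn {suc n} fz     (fs e) = refl
pinch-punchIn {suc n} (fs j) fz     = refl
pinch-punchIn {suc n} (fs j) (fs e) = cong fs (pinch-punchIn j e)

punchIn-fs-self : ∀ {n} (j : Fin n) → punchIn (fs j) j ≡ inject₁ j
punchIn-fs-self fz     = refl
punchIn-fs-self (fs j) = cong fs (punchIn-fs-self j)

pinch-fs-self : ∀ {n} (j : Fin n) → pinch j (fs j) ≡ j
pinch-fs-self {suc n} fz     = refl
pinch-fs-self {suc n} (fs j) = cong fs (pinch-fs-self j)

punchIn-pinch-fs : ∀ {n} (j : Fin n) → punchIn (fs j) (pinch j (fs j)) ≡ inject₁ j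
punchIn-pinch-fs j = trans (cong (punchIn (fs j)) (pinch-fs-self j)) (punchIn-fs-self j)

inject₁<fs : ∀ {n} (j : Fin n) → inject₁ j < fs j
inject₁<fs j = s≤s (ℕₚ.≤-reflexive (toℕ-inject₁ j))

∈-cong : ∀ {n n′} {S : Subset n} {S′ : Subset n′} {x y} → lookup S x ≡ lookup S′ y → x ∈ S ⇔ y ∈ S′
∈-cong {S = S} {S′} {x} {y} S[x]≡S′[y] = mk⇔
  (λ x∈S → VecP.lookup⇒[]= y S′ (trans (sym S[x]≡S′[y]) (VecP.[]=⇒lookup x∈S)))
  (λ y∈S′ → VecP.lookup⇒[]= x S (trans S[x]≡S′[y] (VecP.[]=⇒lookup y∈S′)))

module _ {n : ℕ} where

  _≟M_ : DecidableEquality (Monomial n)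
  _≟M_ = VecP.≡-dec _≟ℕ_

  coeff-∷ : ∀ μ ν (f : Poly n) → coeff μ (ν ∷ f) ≡ does (μ ≟M ν) xor coeff μ f
  coeff-∷ μ ν f with does (μ ≟M ν)
  ... | true  = refl
  ... | false = refl

  coeff-++ : ∀ μ (f g : Poly n) → coeff μ (f +P g) ≡ coeff μ f xor coeff μ g
  coeff-++ μ []      g = refl
  coeff-++ μ (ν ∷ f) g = begin
    coeff μ (ν ∷ f ++ g)                 ≡⟨ coeff-∷ μ ν (f ++ g) ⟩
    d xor coeff μ (f ++ g)               ≡⟨ cong (d xor_) (coeff-++ μ f g) ⟩
    d xor (coeff μ f xor coeff μ g)      ≡⟨ xor-assoc d _ _ ⟨
    (d xor coeff μ f) xor coeff μ g      ≡⟨ cong (_xor coeff μ g) (coeff-∷ μ ν f) ⟨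
    coeff μ (ν ∷ f) xor coeff μ g        ∎
    where open ≡-Reasoning
          d = does (μ ≟M ν)

  ≈P-setoid : Setoid _ _
  ≈P-setoid = record
    { Carrier       = Poly n
    ; _≈_           = _≈P_
    ; isEquivalence = record
      { refl  = λ _ → refl
      ; sym   = λ f≈g μ → sym (f≈g μ)
      ; trans = λ f≈g g≈h μ → trans (f≈g μ) (g≈h μ)
      }
    }

  ↭⇒≈P : {f g : Poly n} → f ↭ g → f ≈P g
  ↭⇒≈P f↭g μ = cong (parity {n}) (↭-length (filter-↭ (μ ≟M_) f↭g))

  +P-congˡ : ∀ h {f g : Poly n} → f ≈P g → (h +P f) ≈P (h +P g)
  +P-congˡ h {f} {g} f≈g μ = begin
    coeff μ (h ++ f)                 ≡⟨ coeff-++ μ h f ⟩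
    coeff μ h xor coeff μ f          ≡⟨ cong (coeff μ h xor_) (f≈g μ) ⟩
    coeff μ h xor coeff μ g          ≡⟨ coeff-++ μ h g ⟨
    coeff μ (h ++ g)                 ∎
    where open ≡-Reasoning

  +P-self : (f : Poly n) → (f +P f) ≈P 0P
  +P-self f μ = trans (coeff-++ μ f f) (xor-same (coeff μ f))

  +P-selfˡ : (f g : Poly n) → ((f +P f) +P g) ≈P g
  +P-selfˡ f g μ = trans (coeff-++ μ (f ++ f) g) (cong (_xor coeff μ g) (+P-self f μ))

  ∷-∷-cancel : ∀ ν (f : Poly n) → (ν ∷ ν ∷ f) ≈P f
  ∷-∷-cancel ν f μ = begin
    coeff μ (ν ∷ ν ∷ f)                  ≡⟨ coeff-∷ μ ν (ν ∷ f) ⟩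
    d xor coeff μ (ν ∷ f)                ≡⟨ cong (d xor_) (coeff-∷ μ ν f) ⟩
    d xor (d xor coeff μ f)              ≡⟨ xor-assoc d d _ ⟨
    (d xor d) xor coeff μ f              ≡⟨ cong (_xor coeff μ f) (xor-same d) ⟩
    coeff μ f                            ∎
    where open ≡-Reasoning
          d = does (μ ≟M ν)

  _·_ : Monomial n → Monomial n → Monomial n
  ν · ν′ = tabulate λ i → lookup ν i + lookup ν′ i

  lookup-· : ∀ ν ν′ i → lookup (ν · ν′) i ≡ lookup ν i + lookup ν′ i
  lookup-· ν ν′ i = VecP.lookup∘tabulate _ i

  *P-zeroʳ : (f : Poly n) → f *P 0P ≡ 0P
  *P-zeroʳ []      = refl
  *P-zeroʳ (_ ∷ f) = *P-zeroʳ f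

  *P-identityʳ : (f : Poly n) → f *P 1P ≡ f
  *P-identityʳ []      = refl
  *P-identityʳ (ν ∷ f) = cong₂ _∷_ (·-identityʳ ν) (*P-identityʳ f)
    where
    ·-identityʳ : ∀ ν → ν · tabulate (λ _ → 0) ≡ ν
    ·-identityʳ ν = lookup-ext λ i → begin
      lookup (ν · tabulate (λ _ → 0)) i          ≡⟨ lookup-· ν (tabulate (λ _ → 0)) i ⟩
      lookup ν i + lookup (tabulate (λ _ → 0)) i ≡⟨ cong (lookup ν i +_) (VecP.lookup∘tabulate _ i) ⟩
      lookup ν i + 0                             ≡⟨ +-identityʳ _ ⟩
      lookup ν i                                 ∎
      where open ≡-Reasoning

  *P-congˡ-↭ : (f : Poly n) {g h : Poly n} → g ↭ h → f *P g ↭ f *P h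
  *P-congˡ-↭ []      g↭h = ↭-refl
  *P-congˡ-↭ (ν ∷ f) g↭h = ++⁺ (map⁺ (ν ·_) g↭h) (*P-congˡ-↭ f g↭h)

  *P-distribˡ-+P : (f g h : Poly n) → f *P (g +P h) ↭ (f *P g) +P (f *P h)
  *P-distribˡ-+P []      g h = ↭-refl
  *P-distribˡ-+P (ν ∷ f) g h = begin
    map (ν ·_) (g ++ h) ++ f *P (g ++ h)        ≡⟨ cong (_++ f *P (g ++ h)) (LP.map-++ (ν ·_) g h) ⟩
    (νg ++ νh) ++ f *P (g ++ h)                 ↭⟨ ++⁺ˡ (νg ++ νh) (*P-distribˡ-+P f g h) ⟩
    (νg ++ νh) ++ (f *P g ++ f *P h)            ≡⟨ LP.++-assoc νg νh _ ⟩
    νg ++ (νh ++ (f *P g ++ f *P h))            ↭⟨ ++⁺ˡ νg (shifts νh (f *P g)) ⟩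
    νg ++ (f *P g ++ (νh ++ f *P h))            ≡⟨ LP.++-assoc νg (f *P g) _ ⟨
    (νg ++ f *P g) ++ (νh ++ f *P h)            ∎
    where open PermutationReasoning
          νg = map (ν ·_) g
          νh = map (ν ·_) h

bit : Bool → ℕ
bit b = if b then 1 else 0

varM : ∀ {n} → Fin n → Monomial n
varM e = tabulate λ i → bit (does (i ≟F e))

lookup-varM : ∀ {n} (e i : Fin n) → lookup (varM e) i ≡ bit (does (i ≟F e))
lookup-varM e i = VecP.lookup∘tabulate _ i

subsetM : ∀ {n} → Subset n → Monomial n
subsetM S = tabulate λ i → bit (lookup S i)

lookup-subsetM : ∀ {n} (S : Subset n) i → lookup (subsetM S) i ≡ bit (lookup S i)
lookup-subsetM S i = VecP.lookup∘tabulate _ i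

monomialOf-≡ : ∀ {n} (S : Subset n) {c : Fin n → Bool} →
               (∀ i → lookup S i ≡ c i) → monomialOf S ≡ (tabulate λ i → bit (c i)) ∷ []
monomialOf-≡ S S≡c = cong (_∷ []) (VecP.tabulate-cong (cong bit ∘ S≡c))

_∼[_]_ : ∀ {n} → Poly n → (Poly n → Set) → Poly n → Set
f ∼[ Gen ] g = Ideal Gen (f +P g)

module _ {n : ℕ} {Gen : Poly n → Set} where

  ≈P⇒∼ : (f g : Poly n) → f ≈P g → f ∼[ Gen ] g
  ≈P⇒∼ f g f≈g = ideal-≈ 0≈f+g ideal-0
    where
    open SetoidReasoning ≈P-setoid
    0≈f+g : 0P ≈P (f +P g)
    0≈f+g = begin
      0P      ≈⟨ +P-self f ⟨
      f ++ f  ≈⟨ +P-congˡ f f≈g ⟩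
      f ++ g  ∎

  ∼-refl : (f : Poly n) → f ∼[ Gen ] f
  ∼-refl f = ≈P⇒∼ f f (λ _ → refl)

  ≡⇒∼ : {f g : Poly n} → f ≡ g → f ∼[ Gen ] g
  ≡⇒∼ {f} refl = ∼-refl f

  ∼-sym : {f g : Poly n} → f ∼[ Gen ] g → g ∼[ Gen ] f
  ∼-sym {f} {g} = ideal-≈ (↭⇒≈P (++-comm f g))

  ∼-trans : {f g h : Poly n} → f ∼[ Gen ] g → g ∼[ Gen ] h → f ∼[ Gen ] h
  ∼-trans {f} {g} {h} f∼g g∼h = ideal-≈ sum≈ (ideal-+ f∼g g∼h)
    where
    open SetoidReasoning ≈P-setoid
    sum≈ : ((f ++ g) ++ (g ++ h)) ≈P (f ++ h)
    sum≈ = begin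
      (f ++ g) ++ (g ++ h)   ≈⟨ ↭⇒≈P (shifts (f ++ g) g) ⟩
      g ++ ((f ++ g) ++ h)   ≈⟨ ↭⇒≈P (++⁺ˡ g (++⁺ʳ h (++-comm f g))) ⟩
      g ++ ((g ++ f) ++ h)   ≡⟨ cong (g ++_) (LP.++-assoc g f h) ⟩
      g ++ (g ++ (f ++ h))   ≡⟨ LP.++-assoc g g (f ++ h) ⟨
      (g ++ g) ++ (f ++ h)   ≈⟨ +P-selfˡ g (f ++ h) ⟩
      f ++ h                 ∎

  ideal-cancelˡ : {f g : Poly n} → Ideal Gen (f +P g) → Ideal Gen f → Ideal Gen g
  ideal-cancelˡ {f} f+g∈I f∈I = ∼-trans {f = 0P} {f} f∈I f+g∈I

quotientRing-≅ : ∀ {m n} {Gen : Poly m → Set} {Gen′ : Poly n → Set}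
  (φ : Poly m → Poly n) (ψ : Poly n → Poly m) →
  (∀ f g → φ (f +P g) ≡ φ f +P φ g) →
  (∀ f g → φ (f *P g) ≡ φ f *P φ g) →
  φ 1P ≡ 1P →
  (∀ f g → ψ (f +P g) ≡ ψ f +P ψ g) →
  (∀ {h} → Ideal Gen h → Ideal Gen′ (φ h)) →
  (∀ {h} → Ideal Gen′ h → Ideal Gen (ψ h)) →
  (∀ f → φ (ψ f) ≡ f) →
  (∀ f → f ∼[ Gen ] ψ (φ f)) →
  QuotientRing Gen ≅R QuotientRing Gen′
quotientRing-≅ {Gen = Gen} {Gen′} φ ψ φ-+ φ-* φ-1 ψ-+ φ-ideal ψ-ideal φ∘ψ f∼ψφf = φ , record
  { isRingMonomorphism = record
    { isRingHomomorphism = record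
      { isSemiringHomomorphism = record
        { isNearSemiringHomomorphism = record
          { +-isMonoidHomomorphism = record
            { isMagmaHomomorphism = record
              { isRelHomomorphism = record { cong = φ-cong }
              ; homo = λ f g → ≡⇒∼ (φ-+ f g)
              }
            ; ε-homo = subst (λ h → Ideal Gen′ (h ++ 0P)) (sym (φ-+ 0P 0P))
                             (≈P⇒∼ (φ 0P ++ φ 0P) 0P (+P-self (φ 0P)))
            }
          ; *-homo = λ f g → ≡⇒∼ (φ-* f g)
          }
        ; 1#-homo = ≡⇒∼ φ-1
        }
      ; -‿homo = λ f → ∼-refl (φ f)
      }
    ; injective = injective
    }
  ; surjective = λ g → ψ g , λ {f} f∼ψg → subst (φ f ∼[ Gen′ ]_) (φ∘ψ g) (φ-cong {f} f∼ψg)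
  }
  where
  φ-cong : ∀ {f g} → f ∼[ Gen ] g → φ f ∼[ Gen′ ] φ g
  φ-cong {f} {g} f∼g = subst (Ideal Gen′) (φ-+ f g) (φ-ideal f∼g)

  injective : ∀ {f g} → φ f ∼[ Gen′ ] φ g → f ∼[ Gen ] g
  injective {f} {g} φf∼φg =
    ∼-trans {f = f} (f∼ψφf f)
      (∼-trans {f = ψ (φ f)} (subst (Ideal Gen) (ψ-+ (φ f) (φ g)) (ψ-ideal φf∼φg)) (∼-sym {f = g} (f∼ψφf g)))

ideal-map : ∀ {m n} {Gen : Poly m → Set} {Gen′ : Poly n → Set} (Φ : Poly m → Poly n) →
  Φ 0P ≡ 0P → (∀ f g → Φ (f +P g) ≡ Φ f +P Φ g) → (∀ f g → f ≈P g → Φ f ≈P Φ g) →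
  (∀ a g → Gen g → Ideal Gen′ (Φ (a *P g))) →
  ∀ {h} → Ideal Gen h → Ideal Gen′ (Φ h)
ideal-map {Gen′ = Gen′} Φ Φ-0 Φ-+ Φ-≈P Φ-gen = go
  where
  go : ∀ {h} → Ideal _ h → Ideal Gen′ (Φ h)
  go ideal-0                   = subst (Ideal Gen′) (sym Φ-0) ideal-0
  go (ideal-gen a g g∈Gen)     = Φ-gen a g g∈Gen
  go (ideal-+ {f} {g} I J)     = subst (Ideal Gen′) (sym (Φ-+ f g)) (ideal-+ (go I) (go J))
  go (ideal-≈ {f} {g} f≈g I)   = ideal-≈ (Φ-≈P f g f≈g) (go I)

module Eliminate {q : ℕ} (k : Fin (suc q)) where

  extendM : Monomial q → Monomial (suc q)
  extendM ν = insertAt ν k 0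

  embed : Poly q → Poly (suc q)
  embed = map extendM

  eval₀ : Poly (suc q) → Poly q
  eval₀ []      = []
  eval₀ (ν ∷ f) with lookup ν k
  ... | zero  = removeAt ν k ∷ eval₀ f
  ... | suc _ = eval₀ f

  extendM-removeAt : ∀ ν → lookup ν k ≡ 0 → extendM (removeAt ν k) ≡ ν
  extendM-removeAt ν ν[k]≡0 =
    subst (λ v → insertAt (removeAt ν k) k v ≡ ν) ν[k]≡0 (VecP.insertAt-removeAt ν k)

  extendM-· : ∀ ν ν′ → extendM (ν · ν′) ≡ extendM ν · extendM ν′
  extendM-· ν ν′ = sym (≡-insertAt at-k at-punchIn)
    where
    at-k : lookup (extendM ν · extendM ν′) k ≡ 0
    at-k = trans (lookup-· (extendM ν) (extendM ν′) k)
                 (cong₂ _+_ (VecP.insertAt-lookup ν k 0) (VecP.insertAt-lookup ν′ k 0))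
    at-punchIn : ∀ e → lookup (extendM ν · extendM ν′) (punchIn k e) ≡ lookup (ν · ν′) e
    at-punchIn e = begin
      lookup (extendM ν · extendM ν′) (punchIn k e)                        ≡⟨ lookup-· (extendM ν) (extendM ν′) _ ⟩
      lookup (extendM ν) (punchIn k e) + lookup (extendM ν′) (punchIn k e) ≡⟨ cong₂ _+_ (VecP.insertAt-punchIn ν k 0 e)
                                                                                        (VecP.insertAt-punchIn ν′ k 0 e) ⟩
      lookup ν e + lookup ν′ e                                             ≡⟨ lookup-· ν ν′ e ⟨
      lookup (ν · ν′) e                                                    ∎
      where open ≡-Reasoning

  removeAt-· : ∀ ν ν′ → removeAt (ν · ν′) k ≡ removeAt ν k · removeAt ν′ k
  removeAt-· ν ν′ = lookup-ext λ e → begin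
    lookup (removeAt (ν · ν′) k) e                      ≡⟨ lookup-removeAt (ν · ν′) k e ⟩
    lookup (ν · ν′) (punchIn k e)                       ≡⟨ lookup-· ν ν′ _ ⟩
    lookup ν (punchIn k e) + lookup ν′ (punchIn k e)    ≡⟨ cong₂ _+_ (lookup-removeAt ν k e)
                                                                     (lookup-removeAt ν′ k e) ⟨
    lookup (removeAt ν k) e + lookup (removeAt ν′ k) e  ≡⟨ lookup-· (removeAt ν k) (removeAt ν′ k) e ⟨
    lookup (removeAt ν k · removeAt ν′ k) e             ∎
    where open ≡-Reasoning

  eval₀-++ : ∀ f g → eval₀ (f +P g) ≡ eval₀ f +P eval₀ g
  eval₀-++ []      g = refl
  eval₀-++ (ν ∷ f) g with lookup ν k
  ... | zero  = cong (removeAt ν k ∷_) (eval₀-++ f g)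
  ... | suc _ = eval₀-++ f g

  eval₀-∷-zero : ∀ ν f → lookup ν k ≡ 0 → eval₀ (ν ∷ f) ≡ removeAt ν k ∷ eval₀ f
  eval₀-∷-zero ν f ν[k]≡0 rewrite ν[k]≡0 = refl

  eval₀-∷-suc : ∀ ν {t} f → lookup ν k ≡ suc t → eval₀ (ν ∷ f) ≡ eval₀ f
  eval₀-∷-suc ν f ν[k]≡1+t rewrite ν[k]≡1+t = refl

  eval₀-map-·-zero : ∀ ν g → lookup ν k ≡ 0 → eval₀ (map (ν ·_) g) ≡ map (removeAt ν k ·_) (eval₀ g)
  eval₀-map-·-zero ν []       ν[k]≡0 = refl
  eval₀-map-·-zero ν (ν′ ∷ g) ν[k]≡0 with lookup ν′ k in ν′[k]
  ... | zero  = trans (eval₀-∷-zero (ν · ν′) _ (trans (lookup-· ν ν′ k) (cong₂ _+_ ν[k]≡0 ν′[k])))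
                      (cong₂ _∷_ (removeAt-· ν ν′) (eval₀-map-·-zero ν g ν[k]≡0))
  ... | suc t = trans (eval₀-∷-suc (ν · ν′) _ (trans (lookup-· ν ν′ k) (cong₂ _+_ ν[k]≡0 ν′[k])))
                      (eval₀-map-·-zero ν g ν[k]≡0)

  eval₀-map-·-suc : ∀ ν g {t} → lookup ν k ≡ suc t → eval₀ (map (ν ·_) g) ≡ []
  eval₀-map-·-suc ν []       ν[k]≡1+t = refl
  eval₀-map-·-suc ν (ν′ ∷ g) ν[k]≡1+t =
    trans (eval₀-∷-suc (ν · ν′) _ (trans (lookup-· ν ν′ k) (cong (_+ lookup ν′ k) ν[k]≡1+t)))
          (eval₀-map-·-suc ν g ν[k]≡1+t)

  eval₀-*P : ∀ f g → eval₀ (f *P g) ≡ eval₀ f *P eval₀ g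
  eval₀-*P []      g = refl
  eval₀-*P (ν ∷ f) g with lookup ν k in ν[k]
  ... | zero  = trans (eval₀-++ (map (ν ·_) g) (f *P g)) (cong₂ _++_ (eval₀-map-·-zero ν g ν[k]) (eval₀-*P f g))
  ... | suc _ = trans (eval₀-++ (map (ν ·_) g) (f *P g)) (cong₂ _++_ (eval₀-map-·-suc ν g ν[k]) (eval₀-*P f g))

  eval₀-1P : eval₀ 1P ≡ 1P
  eval₀-1P = trans (eval₀-∷-zero 0M [] (VecP.lookup∘tabulate _ k)) (cong (_∷ []) (lookup-ext removeAt-0M))
    where
    0M : ∀ {n} → Monomial n
    0M = tabulate λ _ → 0
    removeAt-0M : ∀ e → lookup (removeAt 0M k) e ≡ lookup 0M e
    removeAt-0M e = trans (lookup-removeAt 0M k e)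
                          (trans (VecP.lookup∘tabulate _ (punchIn k e)) (sym (VecP.lookup∘tabulate _ e)))

  eval₀∘embed : ∀ f → eval₀ (embed f) ≡ f
  eval₀∘embed []      = refl
  eval₀∘embed (ν ∷ f) = trans (eval₀-∷-zero (extendM ν) (embed f) (VecP.insertAt-lookup ν k 0))
                              (cong₂ _∷_ (VecP.removeAt-insertAt ν k 0) (eval₀∘embed f))

  embed-*P : ∀ f g → embed (f *P g) ≡ embed f *P embed g
  embed-*P []      g = refl
  embed-*P (ν ∷ f) g = begin
    map extendM (map (ν ·_) g ++ f *P g)                 ≡⟨ LP.map-++ extendM (map (ν ·_) g) (f *P g) ⟩
    map extendM (map (ν ·_) g) ++ embed (f *P g)         ≡⟨ cong₂ _++_ embed-map-· (embed-*P f g) ⟩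
    map (extendM ν ·_) (embed g) ++ embed f *P embed g   ∎
    where
    open ≡-Reasoning
    embed-map-· : map extendM (map (ν ·_) g) ≡ map (extendM ν ·_) (embed g)
    embed-map-· = trans (sym (LP.map-∘ g)) (trans (LP.map-cong (extendM-· ν) g) (LP.map-∘ g))

  coeff-eval₀ : ∀ μ f → coeff μ (eval₀ f) ≡ coeff (extendM μ) f
  coeff-eval₀ μ []      = refl
  coeff-eval₀ μ (ν ∷ f) with lookup ν k in ν[k]
  ... | zero  = begin
    coeff μ (removeAt ν k ∷ eval₀ f)                      ≡⟨ coeff-∷ μ (removeAt ν k) (eval₀ f) ⟩
    does (μ ≟M removeAt ν k) xor coeff μ (eval₀ f)        ≡⟨ cong₂ _xor_ (does-⇔ (mk⇔ to from) (μ ≟M removeAt ν k) (extendM μ ≟M ν))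
                                                                         (coeff-eval₀ μ f) ⟩
    does (extendM μ ≟M ν) xor coeff (extendM μ) f         ≡⟨ coeff-∷ (extendM μ) ν f ⟨
    coeff (extendM μ) (ν ∷ f)                             ∎
    where
    open ≡-Reasoning
    to : μ ≡ removeAt ν k → extendM μ ≡ ν
    to refl = extendM-removeAt ν ν[k]
    from : extendM μ ≡ ν → μ ≡ removeAt ν k
    from refl = sym (VecP.removeAt-insertAt μ k 0)
  ... | suc _ = begin
    coeff μ (eval₀ f)                                     ≡⟨ coeff-eval₀ μ f ⟩
    coeff (extendM μ) f                                   ≡⟨ cong (_xor coeff (extendM μ) f)
                                                                  (dec-false (extendM μ ≟M ν) extendM-μ≢ν) ⟨
    does (extendM μ ≟M ν) xor coeff (extendM μ) f         ≡⟨ coeff-∷ (extendM μ) ν f ⟨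
    coeff (extendM μ) (ν ∷ f)                             ∎
    where
    open ≡-Reasoning
    extendM-μ≢ν : extendM μ ≢ ν
    extendM-μ≢ν refl = 0≢1+n (trans (sym (VecP.insertAt-lookup μ k 0)) ν[k])

  coeff-embed-extendM : ∀ μ f → coeff (extendM μ) (embed f) ≡ coeff μ f
  coeff-embed-extendM μ f = trans (sym (coeff-eval₀ μ (embed f))) (cong (coeff μ) (eval₀∘embed f))

  coeff-embed-suc : ∀ μ f {t} → lookup μ k ≡ suc t → coeff μ (embed f) ≡ false
  coeff-embed-suc μ []      μ[k] = refl
  coeff-embed-suc μ (ν ∷ f) μ[k] = begin
    coeff μ (extendM ν ∷ embed f)                         ≡⟨ coeff-∷ μ (extendM ν) (embed f) ⟩
    does (μ ≟M extendM ν) xor coeff μ (embed f)           ≡⟨ cong₂ _xor_ (dec-false (μ ≟M extendM ν) μ≢extendM-ν)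
                                                                         (coeff-embed-suc μ f μ[k]) ⟩
    false                                                 ∎
    where
    open ≡-Reasoning
    μ≢extendM-ν : μ ≢ extendM ν
    μ≢extendM-ν refl = 0≢1+n (trans (sym (VecP.insertAt-lookup ν k 0)) μ[k])

  eval₀-≈P : ∀ f g → f ≈P g → eval₀ f ≈P eval₀ g
  eval₀-≈P f g f≈g μ = trans (coeff-eval₀ μ f) (trans (f≈g (extendM μ)) (sym (coeff-eval₀ μ g)))

  embed-≈P : ∀ f g → f ≈P g → embed f ≈P embed g
  embed-≈P f g f≈g μ with lookup μ k in μ[k]
  ... | zero  = subst (λ μ′ → coeff μ′ (embed f) ≡ coeff μ′ (embed g)) (extendM-removeAt μ μ[k])
                  (trans (coeff-embed-extendM _ f) (trans (f≈g _) (sym (coeff-embed-extendM _ g))))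
  ... | suc _ = trans (coeff-embed-suc μ f μ[k]) (sym (coeff-embed-suc μ g μ[k]))

  divideByVar : Poly (suc q) → Poly (suc q)
  divideByVar []      = []
  divideByVar (ν ∷ f) with lookup ν k
  ... | zero  = divideByVar f
  ... | suc _ = updateAt ν k pred ∷ divideByVar f

  updateAt-pred-·-varM : ∀ ν {t} → lookup ν k ≡ suc t → updateAt ν k pred · varM k ≡ ν
  updateAt-pred-·-varM ν {t} ν[k] = lookup-ext λ i → trans (lookup-· (updateAt ν k pred) (varM k) i) (entry i)
    where
    entry : ∀ i → lookup (updateAt ν k pred) i + lookup (varM k) i ≡ lookup ν i
    entry i with i ≟F k
    ... | yes refl = begin
      lookup (updateAt ν i pred) i + lookup (varM i) i   ≡⟨ cong₂ _+_ (VecP.lookup∘updateAt i ν) (lookup-varM i i) ⟩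
      pred (lookup ν i) + bit (does (i ≟F i))            ≡⟨ cong₂ (λ m b → pred m + bit b) ν[k] (dec-true (i ≟F i) refl) ⟩
      t + 1                                              ≡⟨ +-comm t 1 ⟩
      suc t                                              ≡⟨ ν[k] ⟨
      lookup ν i                                         ∎
      where open ≡-Reasoning
    ... | no i≢k = begin
      lookup (updateAt ν k pred) i + lookup (varM k) i   ≡⟨ cong₂ _+_ (VecP.lookup∘updateAt′ i k i≢k ν) (lookup-varM k i) ⟩
      lookup ν i + bit (does (i ≟F k))                   ≡⟨ cong (λ b → lookup ν i + bit b) (dec-false (i ≟F k) i≢k) ⟩
      lookup ν i + 0                                     ≡⟨ +-identityʳ _ ⟩
      lookup ν i                                         ∎
      where open ≡-Reasoning

  +P-embed-eval₀ : ∀ f → (f +P embed (eval₀ f)) ≈P (divideByVar f *P var k)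
  +P-embed-eval₀ []      = λ _ → refl
  +P-embed-eval₀ (ν ∷ f) with lookup ν k in ν[k]
  ... | zero  = begin
    ν ∷ f ++ extendM (removeAt ν k) ∷ embed (eval₀ f)  ≡⟨ cong (λ ν′ → ν ∷ f ++ ν′ ∷ embed (eval₀ f))
                                                               (extendM-removeAt ν ν[k]) ⟩
    ν ∷ f ++ ν ∷ embed (eval₀ f)                        ≈⟨ ↭⇒≈P (↭.prep ν (shift ν f _)) ⟩
    ν ∷ ν ∷ f ++ embed (eval₀ f)                        ≈⟨ ∷-∷-cancel ν _ ⟩
    f ++ embed (eval₀ f)                                ≈⟨ +P-embed-eval₀ f ⟩
    divideByVar f *P var k                              ∎
    where open SetoidReasoning ≈P-setoid
  ... | suc _ = begin
    ν ∷ f ++ embed (eval₀ f)                            ≈⟨ +P-congˡ (ν ∷ []) (+P-embed-eval₀ f) ⟩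
    ν ∷ divideByVar f *P var k                          ≡⟨ cong (_∷ divideByVar f *P var k)
                                                                (updateAt-pred-·-varM ν ν[k]) ⟨
    (updateAt ν k pred · varM k) ∷ divideByVar f *P var k ∎
    where open SetoidReasoning ≈P-setoid

  ∼-embed-eval₀ : ∀ {Gen} → (∀ a → Ideal Gen (a *P var k)) → ∀ f → f ∼[ Gen ] embed (eval₀ f)
  ∼-embed-eval₀ var-k-multiples f = ideal-≈ (λ μ → sym (+P-embed-eval₀ f μ)) (var-k-multiples (divideByVar f))

  embed-var : ∀ e → embed (var e) ≡ var (punchIn k e)
  embed-var e = cong (_∷ []) (sym (≡-insertAt k-entry punchIn-entries))
    where
    k-entry : lookup (varM (punchIn k e)) k ≡ 0
    k-entry = trans (lookup-varM (punchIn k e) k) (cong bit (dec-false (k ≟F punchIn k e) (punchInᵢ≢i k e ∘ sym)))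
    punchIn-entries : ∀ e′ → lookup (varM (punchIn k e)) (punchIn k e′) ≡ lookup (varM e) e′
    punchIn-entries e′ = begin
      lookup (varM (punchIn k e)) (punchIn k e′)              ≡⟨ lookup-varM (punchIn k e) (punchIn k e′) ⟩
      bit (does (punchIn k e′ ≟F punchIn k e))                ≡⟨ cong bit (does-⇔ (mk⇔ (punchIn-injective k e′ e) (cong (punchIn k)))
                                                                                  (punchIn k e′ ≟F punchIn k e) (e′ ≟F e)) ⟩
      bit (does (e′ ≟F e))                                    ≡⟨ lookup-varM e e′ ⟨
      lookup (varM e) e′                                      ∎
      where open ≡-Reasoning

  eval₀-var-k : eval₀ (var k) ≡ []
  eval₀-var-k = eval₀-∷-suc (varM k) [] (trans (lookup-varM k k) (cong bit (dec-true (k ≟F k) refl)))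

  embed-monomialOf : ∀ S → embed (monomialOf S) ≡ monomialOf (insertAt S k false)
  embed-monomialOf S = cong (_∷ []) (sym (≡-insertAt k-entry punchIn-entries))
    where
    k-entry : lookup (subsetM (insertAt S k false)) k ≡ 0
    k-entry = trans (lookup-subsetM (insertAt S k false) k) (cong bit (VecP.insertAt-lookup S k false))
    punchIn-entries : ∀ e → lookup (subsetM (insertAt S k false)) (punchIn k e) ≡ lookup (subsetM S) e
    punchIn-entries e = begin
      lookup (subsetM (insertAt S k false)) (punchIn k e)    ≡⟨ lookup-subsetM (insertAt S k false) (punchIn k e) ⟩
      bit (lookup (insertAt S k false) (punchIn k e))        ≡⟨ cong bit (VecP.insertAt-punchIn S k false e) ⟩
      bit (lookup S e)                                       ≡⟨ lookup-subsetM S e ⟨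
      lookup (subsetM S) e                                   ∎
      where open ≡-Reasoning

  eval₀-monomialOf : ∀ S → lookup S k ≡ true → eval₀ (monomialOf S) ≡ []
  eval₀-monomialOf S S[k] = eval₀-∷-suc (subsetM S) [] (trans (lookup-subsetM S k) (cong bit S[k]))

  linearOf-insertAt : ∀ D b → linearOf (insertAt D k b) ↭ (if b then var k else 0P) +P embed (linearOf D)
  linearOf-insertAt D b = begin
    linearOf D⁺                                               ≡⟨ linearOf-tabulate D⁺ ⟩
    concat (L.tabulate (term D⁺))                             ↭⟨ concat-tabulate-↭ (term D⁺) k ⟩
    term D⁺ k ++ concat (L.tabulate (term D⁺ ∘ punchIn k))     ≡⟨ cong₂ _++_ k-term (cong concat (LP.tabulate-cong punchIn-term)) ⟩
    (if b then var k else 0P) ++ concat (L.tabulate (embed ∘ term D)) ≡⟨ cong (_ ++_) (cong concat (LP.map-tabulate (term D) embed)) ⟨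
    (if b then var k else 0P) ++ concat (map embed (L.tabulate (term D))) ≡⟨ cong (_ ++_) (LP.concat-map (L.tabulate (term D))) ⟩
    (if b then var k else 0P) ++ embed (concat (L.tabulate (term D))) ≡⟨ cong (λ h → _ ++ embed h) (linearOf-tabulate D) ⟨
    (if b then var k else 0P) ++ embed (linearOf D)           ∎
    where
    open PermutationReasoning
    D⁺ = insertAt D k b
    term : ∀ {n} → Subset n → Fin n → Poly n
    term S i = if lookup S i then var i else 0P
    linearOf-tabulate : ∀ {n} (S : Subset n) → linearOf S ≡ concat (L.tabulate (term S))
    linearOf-tabulate S = cong concat (LP.map-tabulate (λ i → i) (term S))
    k-term : term D⁺ k ≡ (if b then var k else 0P)
    k-term = cong (λ c → if c then var k else 0P) (VecP.insertAt-lookup D k b)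
    punchIn-term : ∀ e → term D⁺ (punchIn k e) ≡ embed (term D e)
    punchIn-term e rewrite VecP.insertAt-punchIn D k b e with lookup D e
    ... | true  = sym (embed-var e)
    ... | false = refl

  eval₀-*P-linearOf : ∀ a D → eval₀ (a *P linearOf D) ≈P (eval₀ a *P linearOf (removeAt D k))
  eval₀-*P-linearOf a D = begin
    eval₀ (a *P linearOf D)                     ≡⟨ cong (λ S → eval₀ (a *P linearOf S)) (VecP.insertAt-removeAt D k) ⟨
    eval₀ (a *P linearOf (insertAt D′ k b))     ≈⟨ eval₀-≈P (a *P linearOf (insertAt D′ k b)) (a *P (t ++ embed (linearOf D′)))
                                                              (↭⇒≈P (*P-congˡ-↭ a (linearOf-insertAt D′ b))) ⟩
    eval₀ (a *P (t ++ embed (linearOf D′)))     ≡⟨ eval₀-*P a (t ++ embed (linearOf D′)) ⟩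
    eval₀ a *P eval₀ (t ++ embed (linearOf D′)) ≡⟨ cong (eval₀ a *P_) (eval₀-++ t (embed (linearOf D′))) ⟩
    eval₀ a *P (eval₀ t ++ eval₀ (embed (linearOf D′))) ≡⟨ cong (λ h → eval₀ a *P (h ++ eval₀ (embed (linearOf D′))))
                                                                (eval₀-term b) ⟩
    eval₀ a *P eval₀ (embed (linearOf D′))      ≡⟨ cong (eval₀ a *P_) (eval₀∘embed (linearOf D′)) ⟩
    eval₀ a *P linearOf D′                      ∎
    where
    open SetoidReasoning ≈P-setoid
    D′ = removeAt D k
    b = lookup D k
    t = if b then var k else 0P
    eval₀-term : ∀ b → eval₀ (if b then var k else 0P) ≡ []
    eval₀-term true  = eval₀-var-k
    eval₀-term false = refl

  *P-linearOf-insertAt : ∀ a D b →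
    (a *P linearOf (insertAt D k b)) ↭ ((a *P (if b then var k else 0P)) +P (a *P embed (linearOf D)))
  *P-linearOf-insertAt a D b = ↭-trans (*P-congˡ-↭ a (linearOf-insertAt D b)) (*P-distribˡ-+P a _ _)

module _ {p n : ℕ} (H : Graph p n) where

  minF-≤ˡ : ∀ {n′} (a b : Fin n′) → minF H a b ≤ a
  minF-≤ˡ a b with toℕ a ≤ᵇ toℕ b in a≤ᵇb
  ... | true  = ≤-refl
  ... | false = ≰⇒≥ λ a≤b → subst T a≤ᵇb (≤⇒≤ᵇ a≤b)

  minF-≤ʳ : ∀ {n′} (a b : Fin n′) → minF H a b ≤ b
  minF-≤ʳ a b with toℕ a ≤ᵇ toℕ b in a≤ᵇb
  ... | true  = ≤ᵇ⇒≤ (toℕ a) (toℕ b) (subst T (sym a≤ᵇb) tt)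
  ... | false = ≤-refl

  minF-sel : ∀ {n′} (a b : Fin n′) → minF H a b ≡ a ⊎ minF H a b ≡ b
  minF-sel a b with toℕ a ≤ᵇ toℕ b
  ... | true  = inj₁ refl
  ... | false = inj₂ refl

  minEdge-≤ : ∀ {m} (es : Fin (suc m) → Fin n) i → minEdge H es ≤ es i
  minEdge-≤ {zero}  es fz     = ≤-refl
  minEdge-≤ {suc m} es fz     = minF-≤ˡ (es fz) _
  minEdge-≤ {suc m} es (fs i) = ≤-trans (minF-≤ʳ (es fz) (minEdge H (es ∘ fs))) (minEdge-≤ (es ∘ fs) i)

  minEdge-∈ : ∀ {m} (es : Fin (suc m) → Fin n) → ∃ λ i → es i ≡ minEdge H es
  minEdge-∈ {zero}  es = fz , refl
  minEdge-∈ {suc m} es with minF-sel (es fz) (minEdge H (es ∘ fs)) | minEdge-∈ (es ∘ fs)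
  ... | inj₁ min≡es0 | _          = fz , sym min≡es0
  ... | inj₂ min≡min | i , es≡min = fs i , trans es≡min (sym min≡min)

  minEdge-≡ : ∀ {m} (es : Fin (suc m) → Fin n) {x} i → es i ≡ x → (∀ i → x ≤ es i) → minEdge H es ≡ x
  minEdge-≡ es i refl x≤es with minEdge-∈ es
  ... | i₀ , es-i₀≡min = ≤-antisym (minEdge-≤ es i) (subst (es i ≤_) es-i₀≡min (x≤es i₀))

  InBroken : ∀ {m} → (Fin (suc m) → Fin n) → Fin n → Set
  InBroken es e = (∃ λ i → es i ≡ e) × e ≢ minEdge H es

  inBroken? : ∀ {m} (es : Fin (suc m) → Fin n) e → Dec (InBroken es e)
  inBroken? es e = any? (λ i → es i ≟F e) ×-dec ¬? (e ≟F minEdge H es)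

  lookup-brokenCircuit : ∀ (C : Cycle H) e → lookup (brokenCircuit H C) e ≡ does (inBroken? (Cycle.es C) e)
  lookup-brokenCircuit C e =
    trans (VecP.lookup∘tabulate _ e) (cong (_∧ not (does (e ≟F minEdge H (Cycle.es C)))) (VecP.lookup∘tabulate _ e))

minEdge-∘ : ∀ {p p′ n n′} (H : Graph p n) (H′ : Graph p′ n′) {m} (h : Fin n → Fin n′) →
            (∀ {x y} → x ≤ y → h x ≤ h y) → (es : Fin (suc m) → Fin n) → minEdge H′ (h ∘ es) ≡ h (minEdge H es)
minEdge-∘ H H′ h h-mono es with minEdge-∈ H es
... | i₀ , es-i₀≡min = minEdge-≡ H′ (h ∘ es) i₀ (cong h es-i₀≡min) (λ i → h-mono (minEdge-≤ H es i))

module DeleteEdge {p q : ℕ} (G : Graph p (suc q)) (k : Fin (suc q)) where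

  G′ : Graph p q
  G′ = delete G k

  conn-delete : ∀ {S S′} → (∀ e → S (punchIn k e) → S′ e) → ¬ S k → ∀ {u v} → Conn G S u v → Conn G′ S′ u v
  conn-delete S⇒S′ ¬Sk here = here
  conn-delete S⇒S′ ¬Sk (step e Se J c) with punchInView k e
  ... | hole       = ⊥-elim (¬Sk Se)
  ... | punched e′ = step e′ (S⇒S′ e′ Se) J (conn-delete S⇒S′ ¬Sk c)

  conn-lift : ∀ {S S′} → (∀ e → S′ e → S (punchIn k e)) → ∀ {u v} → Conn G′ S′ u v → Conn G S u v
  conn-lift S′⇒S here             = here
  conn-lift S′⇒S (step e S′e J c) = step (punchIn k e) (S′⇒S e S′e) J (conn-lift S′⇒S c)

  liftCycle : Cycle G′ → Cycle G
  liftCycle C = record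
    { m      = m
    ; es     = punchIn k ∘ es
    ; vs     = vs
    ; closed = closed
    ; es-inj = λ i i′ → es-inj i i′ ∘ punchIn-injective k (es i) (es i′)
    ; vs-inj = vs-inj
    ; incid  = incid
    }
    where open Cycle C

  inBroken-liftCycle : ∀ {m} (es : Fin (suc m) → Fin q) →
    ¬ InBroken G (punchIn k ∘ es) k × (∀ e → InBroken G (punchIn k ∘ es) (punchIn k e) ⇔ InBroken G′ es e)
  inBroken-liftCycle es = (λ ((i , es-i≡k) , _) → punchInᵢ≢i k (es i) es-i≡k) , λ e → mk⇔
      (λ ((i , eq) , e≢min) → (i , punchIn-injective k (es i) e eq) ,
                              λ e≡min′ → e≢min (trans (cong (punchIn k) e≡min′) (sym min≡)))
      (λ ((i , eq) , e≢min′) → (i , cong (punchIn k) eq) ,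
                               λ e≡min → e≢min′ (punchIn-injective k e _ (trans e≡min min≡)))
    where
    min≡ : minEdge G (punchIn k ∘ es) ≡ punchIn k (minEdge G′ es)
    min≡ = minEdge-∘ G′ G (punchIn k) (λ {x} {y} → punchIn-mono-≤ k x y) es

  brokenCircuit-≡-insertAt : (C : Cycle G) (C′ : Cycle G′) →
    ¬ InBroken G (Cycle.es C) k → (∀ e → InBroken G (Cycle.es C) (punchIn k e) ⇔ InBroken G′ (Cycle.es C′) e) →
    brokenCircuit G C ≡ insertAt (brokenCircuit G′ C′) k false
  brokenCircuit-≡-insertAt C C′ k∉ e∈⇔ = ≡-insertAt
    (trans (lookup-brokenCircuit G C k) (dec-false (inBroken? G (Cycle.es C) k) k∉))
    (λ e → trans (lookup-brokenCircuit G C (punchIn k e))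
             (trans (does-⇔ (e∈⇔ e) (inBroken? G _ _) (inBroken? G′ _ _)) (sym (lookup-brokenCircuit G′ C′ e))))

  brokenCircuit-liftCycle : ∀ C′ → brokenCircuit G (liftCycle C′) ≡ insertAt (brokenCircuit G′ C′) k false
  brokenCircuit-liftCycle C′ = brokenCircuit-≡-insertAt (liftCycle C′) C′ (proj₁ lifted) (proj₂ lifted)
    where lifted = inBroken-liftCycle (Cycle.es C′)

  module _ (k<kOf : toℕ k ℕ.< kOf G) where

    kOf-delete : kOf G ≡ suc (kOf G′)
    kOf-delete = +-∸-assoc 1 {suc q} {p} (ℕₚ.≤-pred (m∸n≢0⇒n<m λ kOf≡0 →
                   ℕₚ.n≮0 (subst (toℕ k ℕ.<_) kOf≡0 k<kOf)))

    k∉tree : ¬ InTree G k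
    k∉tree = <⇒≱ k<kOf

    inTree-delete : ∀ e → InTree G (punchIn k e) ⇔ InTree G′ e
    inTree-delete e = mk⇔ to from
      where
      k≤kOf′ : toℕ k ℕ.≤ kOf G′
      k≤kOf′ = ℕₚ.≤-pred (subst (toℕ k ℕ.<_) kOf-delete k<kOf)
      to : InTree G (punchIn k e) → InTree G′ e
      to tree with <-≤-connex (toℕ e) (toℕ k)
      ... | inj₁ e<k = ⊥-elim (<⇒≱ k<kOf (ℕₚ.≤-trans (subst (kOf G ℕ.≤_) (toℕ-punchIn-< k e e<k) tree)
                                                   (ℕₚ.<⇒≤ e<k)))
      ... | inj₂ k≤e = ℕₚ.≤-pred (subst₂ ℕ._≤_ kOf-delete (toℕ-punchIn-≥ k e k≤e) tree)
      from : InTree G′ e → InTree G (punchIn k e)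
      from tree = subst₂ ℕ._≤_ (sym kOf-delete) (sym (toℕ-punchIn-≥ k e (ℕₚ.≤-trans k≤kOf′ tree))) (s≤s tree)

    inCut-delete : ∀ f e → InCut G (punchIn k f) (punchIn k e) ⇔ InCut G′ f e
    inCut-delete f e = mk⇔ (Sum.map (Prod.map down down) (Prod.map down down)) (Sum.map (Prod.map up up) (Prod.map up up))
      where
      down : ∀ {u v} → Conn G (TminusF G (punchIn k f)) u v → Conn G′ (TminusF G′ f) u v
      down = conn-delete (λ x (tree , x≢f) → Equivalence.to (inTree-delete x) tree , x≢f ∘ cong (punchIn k))
                         (k∉tree ∘ proj₁)
      up : ∀ {u v} → Conn G′ (TminusF G′ f) u v → Conn G (TminusF G (punchIn k f)) u v
      up = conn-lift (λ x (tree , x≢f) → Equivalence.from (inTree-delete x) tree , x≢f ∘ punchIn-injective k x f)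

-- InCut G f e is Separates G f applied to the two endpoints of e.
Separates : ∀ {p n} (G : Graph p n) → Fin n → Fin p → Fin p → Set
Separates G f x y = (Conn G (TminusF G f) x (proj₁ (G f)) × Conn G (TminusF G f) y (proj₂ (G f)))
                  ⊎ (Conn G (TminusF G f) x (proj₂ (G f)) × Conn G (TminusF G f) y (proj₁ (G f)))

separates-sym : ∀ {p n} (G : Graph p n) f {x y} → Separates G f x y → Separates G f y x
separates-sym G f = Sum.swap ∘ Sum.map Prod.swap Prod.swap

module Parallel {p n : ℕ} (G : Graph p n) {a b : Fin n} where

  joins-parallel : SameEnds G a b → ∀ {u v} → Joins G b u v → Joins G a u v
  joins-parallel (inj₁ (b₁≡a₁ , b₂≡a₂)) (inj₁ (b₁≡u , b₂≡v)) = inj₁ (trans (sym b₁≡a₁) b₁≡u , trans (sym b₂≡a₂) b₂≡v)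
  joins-parallel (inj₁ (b₁≡a₁ , b₂≡a₂)) (inj₂ (b₁≡v , b₂≡u)) = inj₂ (trans (sym b₁≡a₁) b₁≡v , trans (sym b₂≡a₂) b₂≡u)
  joins-parallel (inj₂ (b₁≡a₂ , b₂≡a₁)) (inj₁ (b₁≡u , b₂≡v)) = inj₂ (trans (sym b₂≡a₁) b₂≡v , trans (sym b₁≡a₂) b₁≡u)
  joins-parallel (inj₂ (b₁≡a₂ , b₂≡a₁)) (inj₂ (b₁≡v , b₂≡u)) = inj₁ (trans (sym b₂≡a₁) b₂≡u , trans (sym b₁≡a₂) b₁≡v)

  inCut-parallel : SameEnds G a b → ∀ f → InCut G f a ⇔ InCut G f b
  inCut-parallel (inj₁ (b₁≡a₁ , b₂≡a₂)) f = mk⇔ (subst₂ (Separates G f) (sym b₁≡a₁) (sym b₂≡a₂))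
                                                (subst₂ (Separates G f) b₁≡a₁ b₂≡a₂)
  inCut-parallel (inj₂ (b₁≡a₂ , b₂≡a₁)) f = mk⇔ (subst₂ (Separates G f) (sym b₁≡a₂) (sym b₂≡a₁) ∘ separates-sym G f)
                                                (separates-sym G f ∘ subst₂ (Separates G f) b₁≡a₂ b₂≡a₁)

  loopCycle : ∀ {u} → Joins G b u u → Cycle G
  loopCycle {u} J = record
    { m = 0 ; es = λ _ → b ; vs = λ _ → u ; closed = refl
    ; es-inj = λ { fz fz _ → refl } ; vs-inj = λ { fz fz _ → refl } ; incid = λ { fz → J } }

  digon : SameEnds G a b → a ≢ b → proj₁ (G a) ≢ proj₂ (G a) → Cycle G
  digon parallel a≢b a₁≢a₂ = record
    { m = 1 ; es = es ; vs = vs ; closed = refl ; es-inj = es-inj ; vs-inj = vs-inj ; incid = incid }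
    where
    es : Fin 2 → Fin n
    es fz      = a
    es (fs fz) = b
    vs : Fin 3 → Fin p
    vs fz           = proj₁ (G a)
    vs (fs fz)      = proj₂ (G a)
    vs (fs (fs fz)) = proj₁ (G a)
    es-inj : ∀ i i′ → es i ≡ es i′ → i ≡ i′
    es-inj fz      fz      _   = refl
    es-inj fz      (fs fz) a≡b = ⊥-elim (a≢b a≡b)
    es-inj (fs fz) fz      b≡a = ⊥-elim (a≢b (sym b≡a))
    es-inj (fs fz) (fs fz) _   = refl
    vs-inj : ∀ i i′ → vs (inject₁ i) ≡ vs (inject₁ i′) → i ≡ i′
    vs-inj fz      fz      _   = refl
    vs-inj fz      (fs fz) eq  = ⊥-elim (a₁≢a₂ eq)
    vs-inj (fs fz) fz      eq  = ⊥-elim (a₁≢a₂ (sym eq))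
    vs-inj (fs fz) (fs fz) _   = refl
    incid : ∀ i → Joins G (es i) (vs (inject₁ i)) (vs (fs i))
    incid fz      = inj₁ (refl , refl)
    incid (fs fz) = Sum.swap parallel

  -- The digon {a, b} has broken circuit {b}; if a, hence b, is a loop, then b alone is a cycle
  -- with empty broken circuit.
  var-multiples-∈-ideal : SameEnds G a b → a < b → ∀ f → Ideal (Generators G) (f *P var b)
  var-multiples-∈-ideal parallel a<b f with proj₁ (G a) ≟F proj₂ (G a)
  ... | yes a₁≡a₂ =
    subst (Ideal _) (*P-identityʳ (f *P var b)) (ideal-gen (f *P var b) 1P (inj₁ (C , sym C̄≡∅)))
    where
    C = loopCycle (subst (λ v → Joins G b (proj₁ (G a)) v) (sym a₁≡a₂) parallel)
    C̄≡∅ : monomialOf (brokenCircuit G C) ≡ 1P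
    C̄≡∅ = monomialOf-≡ (brokenCircuit G C) λ e → trans (lookup-brokenCircuit G C e)
            (dec-false (inBroken? G (Cycle.es C) e) λ ((_ , b≡e) , e≢b) → e≢b (sym b≡e))
  ... | no a₁≢a₂ = ideal-gen f (var b) (inj₁ (C , sym C̄≡b))
    where
    a≢b : a ≢ b
    a≢b a≡b = <-irrefl a≡b a<b
    C = digon parallel a≢b a₁≢a₂
    min≡a : minEdge G (Cycle.es C) ≡ a
    min≡a = minEdge-≡ G (Cycle.es C) fz refl λ { fz → ≤-refl ; (fs fz) → ℕₚ.<⇒≤ a<b }
    C̄⇔b : ∀ e → InBroken G (Cycle.es C) e ⇔ e ≡ b
    C̄⇔b e = mk⇔ (λ { ((fz , a≡e) , e≢min) → ⊥-elim (e≢min (trans (sym a≡e) (sym min≡a)))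
                   ; ((fs fz , b≡e) , _) → sym b≡e })
                 (λ { refl → (fs fz , refl) , λ b≡min → a≢b (sym (trans b≡min min≡a)) })
    C̄≡b : monomialOf (brokenCircuit G C) ≡ var b
    C̄≡b = monomialOf-≡ (brokenCircuit G C) λ e →
            trans (lookup-brokenCircuit G C e) (does-⇔ (C̄⇔b e) (inBroken? G (Cycle.es C) e) (e ≟F b))

module PinchParallel {p q : ℕ} (G : Graph p (suc q)) (j : Fin q) (parallel : SameEnds G (inject₁ j) (fs j)) where

  open DeleteEdge G (fs j) using (G′; brokenCircuit-≡-insertAt)

  -- pinch j merges inject₁ j with fs j, so punchIn (fs j) ∘ pinch j moves fs j onto its parallel
  -- edge inject₁ j and fixes every other edge.
  rerouted : ∀ x → x ≡ fs j × punchIn (fs j) (pinch j x) ≡ inject₁ j ⊎ punchIn (fs j) (pinch j x) ≡ x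
  rerouted x with x ≟F fs j
  ... | yes refl = inj₁ (refl , punchIn-pinch-fs j)
  ... | no x≢k   = inj₂ (punchIn-pinch j x x≢k)

  pinchCycle : (C : Cycle G) → (∀ i i′ → Cycle.es C i ≡ fs j → Cycle.es C i′ ≢ inject₁ j) → Cycle G′
  pinchCycle C not-both = record
    { m      = m
    ; es     = pinch j ∘ es
    ; vs     = vs
    ; closed = closed
    ; es-inj = es-inj′
    ; vs-inj = vs-inj
    ; incid  = incid′
    }
    where
    open Cycle C
    es-inj′ : ∀ i i′ → pinch j (es i) ≡ pinch j (es i′) → i ≡ i′
    es-inj′ i i′ eq with rerouted (es i) | rerouted (es i′)
    ... | inj₁ (es-i≡k , _) | inj₁ (es-i′≡k , _) = es-inj i i′ (trans es-i≡k (sym es-i′≡k))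
    ... | inj₁ (es-i≡k , r) | inj₂ r′ =
      ⊥-elim (not-both i i′ es-i≡k (trans (sym r′) (trans (cong (punchIn (fs j)) (sym eq)) r)))
    ... | inj₂ r | inj₁ (es-i′≡k , r′) =
      ⊥-elim (not-both i′ i es-i′≡k (trans (sym r) (trans (cong (punchIn (fs j)) eq) r′)))
    ... | inj₂ r | inj₂ r′ = es-inj i i′ (trans (sym r) (trans (cong (punchIn (fs j)) eq) r′))
    incid′ : ∀ i → Joins G (punchIn (fs j) (pinch j (es i))) (vs (inject₁ i)) (vs (fs i))
    incid′ i with rerouted (es i)
    ... | inj₁ (es-i≡k , r) = subst (λ x → Joins G x _ _) (sym r)
                                (Parallel.joins-parallel G parallel (subst (λ x → Joins G x _ _) es-i≡k (incid i)))
    ... | inj₂ r = subst (λ x → Joins G x _ _) (sym r) (incid i)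

  module _ (C : Cycle G) (k∉C̄ : ¬ InBroken G (Cycle.es C) (fs j)) where

    open Cycle C using (es)

    inject₁∈⇒min≢fs : ∀ i → es i ≡ inject₁ j → minEdge G es ≢ fs j
    inject₁∈⇒min≢fs i es-i≡j min≡k = <⇒≱ (inject₁<fs j) (subst₂ _≤_ min≡k es-i≡j (minEdge-≤ G es i))

    not-both : ∀ i i′ → es i ≡ fs j → es i′ ≢ inject₁ j
    not-both i i′ es-i≡k es-i′≡j = k∉C̄ ((i , es-i≡k) , λ k≡min → inject₁∈⇒min≢fs i′ es-i′≡j (sym k≡min))

    pinchedCycle : Cycle G′
    pinchedCycle = pinchCycle C not-both

    min≡ : minEdge G′ (pinch j ∘ es) ≡ pinch j (minEdge G es)
    min≡ = minEdge-∘ G G′ (pinch j) (pinch-mono-≤ j) es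

    inBroken-pinchCycle : ∀ e → InBroken G es (punchIn (fs j) e) ⇔ InBroken G′ (pinch j ∘ es) e
    inBroken-pinchCycle e = mk⇔ to from
      where
      to : InBroken G es (punchIn (fs j) e) → InBroken G′ (pinch j ∘ es) e
      to ((i , es-i≡e) , e≢min) = (i , trans (cong (pinch j) es-i≡e) (pinch-punchIn j e)) , e≢min′
        where
        e≢min′ : e ≢ minEdge G′ (pinch j ∘ es)
        e≢min′ e≡min′ with rerouted (minEdge G es)
        ... | inj₁ (min≡k , _) = inject₁∈⇒min≢fs i es-i≡inject₁ min≡k
          where
          es-i≡inject₁ : es i ≡ inject₁ j
          es-i≡inject₁ = begin
            es i                                    ≡⟨ es-i≡e ⟩
            punchIn (fs j) e                        ≡⟨ cong (punchIn (fs j)) (trans e≡min′ min≡) ⟩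
            punchIn (fs j) (pinch j (minEdge G es)) ≡⟨ cong (punchIn (fs j) ∘ pinch j) min≡k ⟩
            punchIn (fs j) (pinch j (fs j))         ≡⟨ punchIn-pinch-fs j ⟩
            inject₁ j                               ∎
            where open ≡-Reasoning
        ... | inj₂ r = e≢min (trans (cong (punchIn (fs j)) (trans e≡min′ min≡)) r)
      from : InBroken G′ (pinch j ∘ es) e → InBroken G es (punchIn (fs j) e)
      from ((i , pinch-es-i≡e) , e≢min′) with rerouted (es i)
      ... | inj₁ (es-i≡k , _) with fs j ≟F minEdge G es
      ...   | yes k≡min =
        ⊥-elim (e≢min′ (trans (sym pinch-es-i≡e) (trans (cong (pinch j) (trans es-i≡k k≡min)) (sym min≡))))
      ...   | no k≢min  = ⊥-elim (k∉C̄ ((i , es-i≡k) , k≢min))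
      from ((i , pinch-es-i≡e) , e≢min′) | inj₂ r =
        (i , trans (sym r) (cong (punchIn (fs j)) pinch-es-i≡e)) ,
        λ pe≡min → e≢min′ (trans (sym (pinch-punchIn j e)) (trans (cong (pinch j) pe≡min) (sym min≡)))

    brokenCircuit-pinchCycle : brokenCircuit G C ≡ insertAt (brokenCircuit G′ pinchedCycle) (fs j) false
    brokenCircuit-pinchCycle = brokenCircuit-≡-insertAt C pinchedCycle k∉C̄ inBroken-pinchCycle

module DeleteParallelEdge {p q : ℕ} (G : Graph p (suc q)) (j : Fin q)
                          (k<kOf : toℕ (fs j) ℕ.< kOf G) (parallel : SameEnds G (inject₁ j) (fs j)) where

  open DeleteEdge G (fs j)
  open Eliminate (fs j)
  open PinchParallel G j parallel using (pinchedCycle; brokenCircuit-pinchCycle)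
  open Parallel G using (inCut-parallel; var-multiples-∈-ideal)

  var-k-multiples : ∀ a → Ideal (Generators G) (a *P var (fs j))
  var-k-multiples = var-multiples-∈-ideal parallel (inject₁<fs j)

  cut-removeAt : ∀ {f′ D} → (∀ e → e ∈ D ⇔ InCut G (punchIn (fs j) f′) e) →
                 ∀ e → e ∈ removeAt D (fs j) ⇔ InCut G′ f′ e
  cut-removeAt {f′} {D} D⇔cut e = begin
    e ∈ removeAt D (fs j)                           ≈⟨ ∈-cong (lookup-removeAt D (fs j) e) ⟩
    punchIn (fs j) e ∈ D                            ≈⟨ D⇔cut (punchIn (fs j) e) ⟩
    InCut G (punchIn (fs j) f′) (punchIn (fs j) e)  ≈⟨ inCut-delete k<kOf f′ e ⟩
    InCut G′ f′ e                                   ∎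
    where open SetoidReasoning (⇔-setoid 0ℓ)

  cut-insertAt : ∀ {f′ D′} → (∀ e → e ∈ D′ ⇔ InCut G′ f′ e) →
                 ∀ e → e ∈ insertAt D′ (fs j) (lookup D′ j) ⇔ InCut G (punchIn (fs j) f′) e
  cut-insertAt {f′} {D′} D′⇔cut e with punchInView (fs j) e
  ... | hole = begin
    fs j ∈ insertAt D′ (fs j) (lookup D′ j)             ≈⟨ ∈-cong (VecP.insertAt-lookup D′ (fs j) _) ⟩
    j ∈ D′                                              ≈⟨ D′⇔cut j ⟩
    InCut G′ f′ j                                       ≈⟨ inCut-delete k<kOf f′ j ⟨
    InCut G (punchIn (fs j) f′) (punchIn (fs j) j)      ≡⟨ cong (InCut G (punchIn (fs j) f′)) (punchIn-fs-self j) ⟩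
    InCut G (punchIn (fs j) f′) (inject₁ j)             ≈⟨ inCut-parallel parallel (punchIn (fs j) f′) ⟩
    InCut G (punchIn (fs j) f′) (fs j)                  ∎
    where open SetoidReasoning (⇔-setoid 0ℓ)
  ... | punched e′ = begin
    punchIn (fs j) e′ ∈ insertAt D′ (fs j) (lookup D′ j) ≈⟨ ∈-cong (VecP.insertAt-punchIn D′ (fs j) _ e′) ⟩
    e′ ∈ D′                                              ≈⟨ D′⇔cut e′ ⟩
    InCut G′ f′ e′                                       ≈⟨ inCut-delete k<kOf f′ e′ ⟨
    InCut G (punchIn (fs j) f′) (punchIn (fs j) e′)      ∎
    where open SetoidReasoning (⇔-setoid 0ℓ)

  eval₀-*P-brokenCircuit : ∀ a C → Ideal (Generators G′) (eval₀ (a *P monomialOf (brokenCircuit G C)))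
  eval₀-*P-brokenCircuit a C with inBroken? G (Cycle.es C) (fs j)
  ... | yes k∈C̄ = subst (Ideal _) (sym killed) ideal-0
    where
    S = brokenCircuit G C
    k∈S : lookup S (fs j) ≡ true
    k∈S = trans (lookup-brokenCircuit G C (fs j)) (dec-true (inBroken? G _ _) k∈C̄)
    killed : eval₀ (a *P monomialOf S) ≡ 0P
    killed = begin
      eval₀ (a *P monomialOf S)           ≡⟨ eval₀-*P a (monomialOf S) ⟩
      eval₀ a *P eval₀ (monomialOf S)     ≡⟨ cong (eval₀ a *P_) (eval₀-monomialOf S k∈S) ⟩
      eval₀ a *P 0P                       ≡⟨ *P-zeroʳ (eval₀ a) ⟩
      0P                                  ∎
      where open ≡-Reasoning
  ... | no k∉C̄ = subst (Ideal _) (sym pinched) (ideal-gen (eval₀ a) _ (inj₁ (pinchedCycle C k∉C̄ , refl)))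
    where
    S′ = brokenCircuit G′ (pinchedCycle C k∉C̄)
    pinched : eval₀ (a *P monomialOf (brokenCircuit G C)) ≡ eval₀ a *P monomialOf S′
    pinched = begin
      eval₀ (a *P monomialOf (brokenCircuit G C))              ≡⟨ eval₀-*P a _ ⟩
      eval₀ a *P eval₀ (monomialOf (brokenCircuit G C))        ≡⟨ cong (λ S → eval₀ a *P eval₀ (monomialOf S))
                                                                       (brokenCircuit-pinchCycle C k∉C̄) ⟩
      eval₀ a *P eval₀ (monomialOf (insertAt S′ (fs j) false)) ≡⟨ cong (λ h → eval₀ a *P eval₀ h) (embed-monomialOf S′) ⟨
      eval₀ a *P eval₀ (embed (monomialOf S′))                 ≡⟨ cong (eval₀ a *P_) (eval₀∘embed (monomialOf S′)) ⟩
      eval₀ a *P monomialOf S′                                 ∎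
      where open ≡-Reasoning

  eval₀-*P-cut : ∀ a f → InTree G f → ∀ D → (∀ e → e ∈ D ⇔ InCut G f e) →
                 Ideal (Generators G′) (eval₀ (a *P linearOf D))
  eval₀-*P-cut a f tree D D⇔cut with punchInView (fs j) f
  ... | hole       = ⊥-elim (k∉tree k<kOf tree)
  ... | punched f′ = ideal-≈ (λ μ → sym (eval₀-*P-linearOf a D μ)) (ideal-gen (eval₀ a) _ (inj₂ cut′))
    where
    cut′ = f′ , Equivalence.to (inTree-delete k<kOf f′) tree , removeAt D (fs j) , cut-removeAt D⇔cut , refl

  embed-*P-brokenCircuit : ∀ a C → Ideal (Generators G) (embed (a *P monomialOf (brokenCircuit G′ C)))
  embed-*P-brokenCircuit a C = subst (Ideal _) (sym lifted) (ideal-gen (embed a) _ (inj₁ (liftCycle C , refl)))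
    where
    lifted : embed (a *P monomialOf (brokenCircuit G′ C)) ≡ embed a *P monomialOf (brokenCircuit G (liftCycle C))
    lifted = begin
      embed (a *P monomialOf (brokenCircuit G′ C))                       ≡⟨ embed-*P a _ ⟩
      embed a *P embed (monomialOf (brokenCircuit G′ C))                 ≡⟨ cong (embed a *P_)
                                                                                 (embed-monomialOf (brokenCircuit G′ C)) ⟩
      embed a *P monomialOf (insertAt (brokenCircuit G′ C) (fs j) false) ≡⟨ cong (λ S → embed a *P monomialOf S)
                                                                                 (brokenCircuit-liftCycle C) ⟨
      embed a *P monomialOf (brokenCircuit G (liftCycle C))              ∎
      where open ≡-Reasoning

  -- θ_f of G is the image of θ_f of G ∖ e_k, plus x_k when e_{k-1} ∈ D_f.
  embed-*P-cut : ∀ a f′ → InTree G′ f′ → ∀ D′ → (∀ e → e ∈ D′ ⇔ InCut G′ f′ e) →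
                 Ideal (Generators G) (embed (a *P linearOf D′))
  embed-*P-cut a f′ tree′ D′ D′⇔cut =
    subst (Ideal _) (sym (embed-*P a (linearOf D′))) (ideal-cancelˡ split∈I (k-term∈I (lookup D′ j)))
    where
    D = insertAt D′ (fs j) (lookup D′ j)
    cut∈I : Ideal (Generators G) (embed a *P linearOf D)
    cut∈I = ideal-gen (embed a) _
              (inj₂ (punchIn (fs j) f′ , Equivalence.from (inTree-delete k<kOf f′) tree′ , D , cut-insertAt D′⇔cut , refl))
    split∈I : Ideal (Generators G)
                    ((embed a *P (if lookup D′ j then var (fs j) else 0P)) +P (embed a *P embed (linearOf D′)))
    split∈I = ideal-≈ (↭⇒≈P (*P-linearOf-insertAt (embed a) D′ (lookup D′ j))) cut∈I
    k-term∈I : ∀ b → Ideal (Generators G) (embed a *P (if b then var (fs j) else 0P))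
    k-term∈I true  = var-k-multiples (embed a)
    k-term∈I false = subst (Ideal _) (sym (*P-zeroʳ (embed a))) ideal-0

  eval₀-generator : ∀ a g → Generators G g → Ideal (Generators G′) (eval₀ (a *P g))
  eval₀-generator a _ (inj₁ (C , refl))                  = eval₀-*P-brokenCircuit a C
  eval₀-generator a _ (inj₂ (f , tree , D , D⇔cut , refl)) = eval₀-*P-cut a f tree D D⇔cut

  embed-generator : ∀ a g → Generators G′ g → Ideal (Generators G) (embed (a *P g))
  embed-generator a _ (inj₁ (C , refl))                  = embed-*P-brokenCircuit a C
  embed-generator a _ (inj₂ (f , tree , D , D⇔cut , refl)) = embed-*P-cut a f tree D D⇔cut

  R-≅-delete : R G ≅R R G′
  R-≅-delete = quotientRing-≅ eval₀ embed eval₀-++ eval₀-*P eval₀-1P (LP.map-++ extendM)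
    (ideal-map eval₀ refl eval₀-++ eval₀-≈P eval₀-generator)
    (ideal-map embed refl (LP.map-++ extendM) embed-≈P embed-generator)
    eval₀∘embed (∼-embed-eval₀ var-k-multiples)

lemma4p3 : ∀ {p q} (G : Graph p (suc q)) → Standard G
    → (j : Fin q) → toℕ j + 2 ≡ kOf G
    → SameEnds G (inject₁ j) (fs j)
    → R G ≅R R (delete G (fs j))
lemma4p3 G _ j k≡j+2 parallel = DeleteParallelEdge.R-≅-delete G j k<kOf parallel
  where
  k<kOf : toℕ (fs j) ℕ.< kOf G
  k<kOf = subst (suc (toℕ j) ℕ.<_) (trans (+-comm 2 (toℕ j)) k≡j+2) (ℕₚ.n<1+n (suc (toℕ j)))
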